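{- Let $G$ be a graph without isolated vertices that contains an edge $e$ incident with a vertex of degree at most $2$. If $G'$ is obtained from $G$ by subdividing the edge $e$ any number of times, then $F_t(G) = F_t(G')$.
   Context: Graphs are finite, simple and undirected. Forcing process: given a graph $G$ and an initial set $S \subseteq V(G)$ of colored vertices, at each step a colored vertex that has exactly one non-colored neighbor forces (colors) that neighbor. $S$ is a forcing set if iterating this eventually colors all of $V(G)$. A total forcing set (TF-set) is a forcing set $S$ such that $G[S]$ has no isolated vertex; $F_t(G)$ is the minimum cardinality of a TF-set. Subdividing an edge $uv$ $k$ times replaces it by a path $u u_1 \cdots u_k v$ with new internal vertices. -}

module Defs where

open import Data.Nat using (ℕ; zero; suc; _≤_)
open import Data.Fin using (Fin; zero; suc; _≟_)
open import Data.Fin.Subset using (Subset; _∈_; ∣_∣)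
open import Data.Vec using (tabulate)
open import Data.Bool using (Bool; true; false; _∧_; _∨_; not; T)
open import Data.Product using (Σ; ∃; _×_)
open import Relation.Nullary using (¬_)
open import Relation.Nullary.Decidable using (⌊_⌋)
open import Relation.Binary.PropositionalEquality using (_≡_; _≢_)

AdjRel : ℕ → Set
AdjRel n = Fin n → Fin n → Bool

IsSimple : ∀ {n} → AdjRel n → Set
IsSimple {n} A = (∀ (a b : Fin n) → A a b ≡ A b a) × (∀ (a : Fin n) → A a a ≡ false)

deg : ∀ {n} → AdjRel n → Fin n → ℕ
deg A v = ∣ tabulate (A v) ∣

NoIsolated : ∀ {n} → AdjRel n → Set
NoIsolated {n} A = ∀ (v : Fin n) → ∃ λ w → T (A v w)

-- Forcing closure of an initial colored set S: v gets colored if it is in S,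
-- or if some colored neighbour u has all its neighbours other than v colored
-- (so that v is u's unique non-colored neighbour and u forces v).
data Colored {n : ℕ} (A : AdjRel n) (S : Subset n) : Fin n → Set where
  init  : ∀ {v} → v ∈ S → Colored A S v
  force : ∀ {u v} → Colored A S u → T (A u v)
        → (∀ w → T (A u w) → w ≢ v → Colored A S w) → Colored A S v

ForcingSet : ∀ {n} → AdjRel n → Subset n → Set
ForcingSet {n} A S = ∀ (v : Fin n) → Colored A S v

NoIsolatedIn : ∀ {n} → AdjRel n → Subset n → Set
NoIsolatedIn {n} A S = ∀ (v : Fin n) → v ∈ S → ∃ λ w → w ∈ S × T (A v w)

TFSet : ∀ {n} → AdjRel n → Subset n → Set
TFSet A S = ForcingSet A S × NoIsolatedIn A S

IsFt : ∀ {n} → AdjRel n → ℕ → Set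
IsFt {n} A k = (∃ λ (S : Subset n) → TFSet A S × ∣ S ∣ ≡ k)
             × (∀ (S : Subset n) → TFSet A S → k ≤ ∣ S ∣)

-- Subdividing edge uv once: new vertex is zero, old vertex a becomes suc a;
-- edge uv removed, edges u–zero and zero–v added.
subdivide1 : ∀ {n} → AdjRel n → Fin n → Fin n → AdjRel (suc n)
subdivide1 A u v zero    zero    = false
subdivide1 A u v zero    (suc b) = ⌊ b ≟ u ⌋ ∨ ⌊ b ≟ v ⌋
subdivide1 A u v (suc a) zero    = ⌊ a ≟ u ⌋ ∨ ⌊ a ≟ v ⌋
subdivide1 A u v (suc a) (suc b) =
  A a b ∧ not ((⌊ a ≟ u ⌋ ∧ ⌊ b ≟ v ⌋) ∨ (⌊ a ≟ v ⌋ ∧ ⌊ b ≟ u ⌋))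

subSize : ℕ → ℕ → ℕ
subSize n zero    = n
subSize n (suc k) = subSize (suc n) k

-- Subdividing edge uv k times (path u u_1 ... u_k v): subdivide uv once
-- into u w v, then subdivide the edge w v a further k-1 times.
subdivide : ∀ {n} → AdjRel n → Fin n → Fin n → (k : ℕ) → AdjRel (subSize n k)
subdivide A u v zero    = A
subdivide A u v (suc k) = subdivide (subdivide1 A u v) zero (suc v) k

-- Let B arise from A by subdividing uv once, with new vertex w.  It suffices
-- to trade every TF-set of either graph for a no larger TF-set of the other
-- (Shrinks, sameFt).  Both directions simulate forcing (colored-closed):
--   * B to A (contract): "w is colored" is read as "u and v are colored"; a
--     TF-set of B loses w and gains u and v if w was in it (one of them was
--     already there, being a neighbour of w).
--   * A to B (expand): forcing in A carries over to B as long as w gets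
--     colored once u and v are (NewFollows).  A TF-set of A is kept when this
--     holds and u, v have neighbours in it besides each other; otherwise w
--     replaces an endpoint.  NewFollows is where the hypothesis enters: u has
--     at most one neighbour besides v, which "deg u ≤ 2" implies by counting.
-- After one subdivision w is an endpoint of degree 2 of the edge w v, so
-- induction on the number of subdivisions proves the theorem.
module Submission where

open import Defs
open import Data.Nat using (ℕ; zero; suc; _+_; _≤_; z≤n; s≤s)
open import Data.Nat.Properties using (≤-refl; ≤-reflexive; ≤-trans; ≤-antisym; m≤n⇒m≤1+n; module ≤-Reasoning)
open import Data.Fin using (Fin; zero; suc; _≟_)
open import Data.Fin.Properties using (suc-injective; any?)
open import Data.Fin.Subset using (Subset; _∈_; _∉_; _⊆_; ∣_∣; ⁅_⁆; _∪_; _-_)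
open import Data.Fin.Subset.Properties
  using (_∈?_; x∈⁅x⁆; x∈⁅y⁆⇒x≡y; p⊆p∪q; q⊆p∪q; x∈p∪q⁻; p⊆q⇒∣p∣≤∣q∣;
         x∈p∧x≢y⇒x∈p-y; p─q⊆p; x∈p⇒∣p-x∣<∣p∣; ∪-identityʳ)
open import Data.Vec using ([]; _∷_; tabulate; here; there)
open import Data.Vec.Properties using (lookup⇒[]=; lookup∘tabulate)
open import Data.Bool using (Bool; true; false; _∧_; _∨_; not; T)
open import Data.Bool.Properties using (∨-comm; ∧-comm; T-∧; T-≡)
open import Data.Product using (Σ; ∃; _×_; _,_; proj₁; proj₂)
open import Data.Sum using (_⊎_; inj₁; inj₂; [_,_]′)
import Data.Sum as Sum
open import Data.Empty using (⊥-elim)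
open import Function using (id; _∘_; Equivalence)
open import Relation.Nullary using (¬_; Dec; yes; no; contradiction)
open import Relation.Nullary.Decidable
  using (⌊_⌋; _×-dec_; _⊎-dec_; _→-dec_; ¬?; T?; toWitnessFalse; fromWitnessFalse; isYes≗does)
open import Relation.Binary.PropositionalEquality
  using (_≡_; _≢_; refl; sym; trans; cong; cong₂; subst)

open Equivalence using (to; from)

counterexample : ∀ {P Q : Set} → Dec P → ¬ (P → Q) → P × ¬ Q
counterexample (yes p) ¬p→q = p , λ q → ¬p→q (λ _ → q)
counterexample (no ¬p) ¬p→q = ⊥-elim (¬p→q (λ p → ⊥-elim (¬p p)))

∈-tabulate : ∀ {n} {f : Fin n → Bool} {x} → T (f x) → x ∈ tabulate f
∈-tabulate {f = f} {x} fx = lookup⇒[]= x (tabulate f) (trans (lookup∘tabulate f x) (to T-≡ fx))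

x∉p-x : ∀ {n} {p : Subset n} {x} → x ∉ p - x
x∉p-x {p = _ ∷ _} {zero}  ()
x∉p-x {p = _ ∷ _} {suc x} (there q) = x∉p-x q

∈p-y⁻ : ∀ {n} {p : Subset n} {x y} → x ∈ p - y → x ∈ p × x ≢ y
∈p-y⁻ {p = p} {y = y} q = p─q⊆p p ⁅ y ⁆ q , λ { refl → x∉p-x q }

three-members : ∀ {n} {p : Subset n} {x y z} → x ∈ p → y ∈ p - x → z ∈ p - x - y → 3 ≤ ∣ p ∣
three-members {p = p} {x} {y} {z} x∈ y∈ z∈ = begin
  3                     ≤⟨ s≤s (s≤s (s≤s z≤n)) ⟩
  3 + ∣ p - x - y - z ∣ ≤⟨ s≤s (s≤s (x∈p⇒∣p-x∣<∣p∣ z∈)) ⟩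
  2 + ∣ p - x - y ∣     ≤⟨ s≤s (x∈p⇒∣p-x∣<∣p∣ y∈) ⟩
  1 + ∣ p - x ∣         ≤⟨ x∈p⇒∣p-x∣<∣p∣ x∈ ⟩
  ∣ p ∣                 ∎
  where open ≤-Reasoning

∣p∪⁅x⁆∣≤1+∣p∣ : ∀ {n} (p : Subset n) x → ∣ p ∪ ⁅ x ⁆ ∣ ≤ suc ∣ p ∣
∣p∪⁅x⁆∣≤1+∣p∣ (false ∷ p) zero    = s≤s (≤-reflexive (cong ∣_∣ (∪-identityʳ p)))
∣p∪⁅x⁆∣≤1+∣p∣ (true ∷ p)  zero    = s≤s (m≤n⇒m≤1+n (≤-reflexive (cong ∣_∣ (∪-identityʳ p))))
∣p∪⁅x⁆∣≤1+∣p∣ (false ∷ p) (suc x) = ∣p∪⁅x⁆∣≤1+∣p∣ p x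
∣p∪⁅x⁆∣≤1+∣p∣ (true ∷ p)  (suc x) = s≤s (∣p∪⁅x⁆∣≤1+∣p∣ p x)

x∈p⇒∣p∪⁅x⁆∣≤∣p∣ : ∀ {n} (p : Subset n) {x} → x ∈ p → ∣ p ∪ ⁅ x ⁆ ∣ ≤ ∣ p ∣
x∈p⇒∣p∪⁅x⁆∣≤∣p∣ p {x} x∈p = p⊆q⇒∣p∣≤∣q∣ (λ y∈ → [ id , x∈p-if-y∈⁅x⁆ ]′ (x∈p∪q⁻ p ⁅ x ⁆ y∈))
  where
    x∈p-if-y∈⁅x⁆ : ∀ {y} → y ∈ ⁅ x ⁆ → y ∈ p
    x∈p-if-y∈⁅x⁆ y∈⁅x⁆ = subst (_∈ p) (sym (x∈⁅y⁆⇒x≡y x y∈⁅x⁆)) x∈p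

∣p∪⁅x⁆∪⁅y⁆∣≤1+∣p∣ : ∀ {n} (p : Subset n) {x y} → x ∈ p ⊎ y ∈ p → ∣ (p ∪ ⁅ x ⁆) ∪ ⁅ y ⁆ ∣ ≤ suc ∣ p ∣
∣p∪⁅x⁆∪⁅y⁆∣≤1+∣p∣ p {x} {y} (inj₁ x∈p) = ≤-trans (∣p∪⁅x⁆∣≤1+∣p∣ (p ∪ ⁅ x ⁆) y) (s≤s (x∈p⇒∣p∪⁅x⁆∣≤∣p∣ p x∈p))
∣p∪⁅x⁆∪⁅y⁆∣≤1+∣p∣ p {x} {y} (inj₂ y∈p) = ≤-trans (x∈p⇒∣p∪⁅x⁆∣≤∣p∣ (p ∪ ⁅ x ⁆) (p⊆p∪q ⁅ x ⁆ y∈p)) (∣p∪⁅x⁆∣≤1+∣p∣ p x)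

ForcingClosed : ∀ {n} → AdjRel n → (Fin n → Set) → Set
ForcingClosed {n} A P =
  ∀ {x y} → P x → T (A x y) → (∀ z → T (A x z) → z ≢ y → P z) → P y

colored-closed : ∀ {n} {A : AdjRel n} {S : Subset n} (P : Fin n → Set)
               → (∀ {x} → x ∈ S → P x) → ForcingClosed A P
               → ∀ {x} → Colored A S x → P x
colored-closed P base step (init x∈S) = base x∈S
colored-closed P base step (force cx xy rest) =
  step (colored-closed P base step cx) xy
       (λ z xz z≢y → colored-closed P base step (rest z xz z≢y))

Shrinks : ∀ {n n'} → AdjRel n → AdjRel n' → Set
Shrinks {n} {n'} A A' =
  ∀ S → TFSet A S → Σ (Subset n') λ S' → TFSet A' S' × ∣ S' ∣ ≤ ∣ S ∣

SameFt : ∀ {n n'} → AdjRel n → AdjRel n' → Set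
SameFt A A' = ∀ m → (IsFt A m → IsFt A' m) × (IsFt A' m → IsFt A m)

Ft-transfer : ∀ {n n'} {A : AdjRel n} {A' : AdjRel n'}
            → Shrinks A A' → Shrinks A' A → ∀ m → IsFt A m → IsFt A' m
Ft-transfer {A' = A'} to' from' m ((S , tf , ∣S∣≡m) , min) with to' S tf
... | S' , tf' , ∣S'∣≤∣S∣ =
  (S' , tf' , ≤-antisym (subst (∣ S' ∣ ≤_) ∣S∣≡m ∣S'∣≤∣S∣) (min' S' tf')) , min'
  where
    min' : ∀ S'' → TFSet A' S'' → m ≤ ∣ S'' ∣
    min' S'' tf'' with from' S'' tf''
    ... | S₀ , tf₀ , ∣S₀∣≤ = ≤-trans (min S₀ tf₀) ∣S₀∣≤

sameFt : ∀ {n n'} {A : AdjRel n} {A' : AdjRel n'}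
       → Shrinks A A' → Shrinks A' A → SameFt A A'
sameFt to' from' m = Ft-transfer to' from' m , Ft-transfer from' to' m

sameFt-trans : ∀ {n₁ n₂ n₃} {A₁ : AdjRel n₁} {A₂ : AdjRel n₂} {A₃ : AdjRel n₃}
             → SameFt A₁ A₂ → SameFt A₂ A₃ → SameFt A₁ A₃
sameFt-trans e₁ e₂ m = proj₁ (e₂ m) ∘ proj₁ (e₁ m) , proj₂ (e₁ m) ∘ proj₂ (e₂ m)

TFSet-resp : ∀ {n} {A A' : AdjRel n} {S} → (∀ a b → A a b ≡ A' a b) → TFSet A S → TFSet A' S
TFSet-resp {A = A} {A'} {S} A≡A' (forcing , isolated-free) =
  (λ x → colored-closed (Colored A' S) init step (forcing x)) ,
  (λ a a∈S → let (t , t∈S , at) = isolated-free a a∈S in t , t∈S , transport at)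
  where
    transport : ∀ {a b} → T (A a b) → T (A' a b)
    transport {a} {b} = subst T (A≡A' a b)
    step : ForcingClosed A (Colored A' S)
    step cx xy rest = force cx (transport xy) (λ z xz z≢y → rest z (subst T (sym (A≡A' _ z)) xz) z≢y)

sameFt-resp : ∀ {n} {A A' : AdjRel n} → (∀ a b → A a b ≡ A' a b) → SameFt A A'
sameFt-resp A≡A' = sameFt (λ S tf → S , TFSet-resp A≡A' tf , ≤-refl)
                          (λ S tf → S , TFSet-resp (λ a b → sym (A≡A' a b)) tf , ≤-refl)

HasOtherNbrIn : ∀ {n} → AdjRel n → Subset n → Fin n → Fin n → Set
HasOtherNbrIn {n} A S a b = ∃ λ (t : Fin n) → t ∈ S × T (A a t) × t ≢ b

hasOtherNbrIn? : ∀ {n} (A : AdjRel n) S a b → Dec (HasOtherNbrIn A S a b)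
hasOtherNbrIn? A S a b = any? (λ t → (t ∈? S) ×-dec T? (A a t) ×-dec ¬? (t ≟ b))

-- If a ∈ S has no neighbour in S other than b, then b is its neighbour in S
-- (one exists, as S has no isolated vertex); in particular b ∈ S.
lonely-partner : ∀ {n} {A : AdjRel n} {S a b} → NoIsolatedIn A S → a ∈ S
               → ¬ HasOtherNbrIn A S a b → b ∈ S
lonely-partner {b = b} isolated-free a∈S no-other with isolated-free _ a∈S
... | t , t∈S , at with t ≟ b
...   | yes refl = t∈S
...   | no t≢b = contradiction (t , t∈S , at , t≢b) no-other

AtMostOneOther : ∀ {n} → AdjRel n → Fin n → Fin n → Set
AtMostOneOther A u v =
  ∀ {y z} → T (A u y) → T (A u z) → y ≢ v → z ≢ v → y ≡ z

-- A vertex of degree at most 2 adjacent to v has at most one other neighbour: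
-- two of them, together with v, would be three members of its neighbourhood.
deg≤2⇒atMostOneOther : ∀ {n} {A : AdjRel n} {u v} → T (A u v) → deg A u ≤ 2
                      → AtMostOneOther A u v
deg≤2⇒atMostOneOther {A = A} {u} uv deg≤2 {y} {z} uy uz y≢v z≢v with y ≟ z
... | yes y≡z = y≡z
... | no y≢z = contradiction (≤-trans three deg≤2) λ { (s≤s (s≤s ())) }
  where
    three : 3 ≤ deg A u
    three = three-members (∈-tabulate uv) (x∈p∧x≢y⇒x∈p-y (∈-tabulate uy) y≢v)
              (x∈p∧x≢y⇒x∈p-y (x∈p∧x≢y⇒x∈p-y (∈-tabulate uz) z≢v) (y≢z ∘ sym))

module Subdivision {n : ℕ} (A : AdjRel n) (symA : ∀ a b → A a b ≡ A b a)
                   (u v : Fin n) (uv : T (A u v)) (u≢v : u ≢ v) where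

  B : AdjRel (suc n)
  B = subdivide1 A u v

  vu : T (A v u)
  vu = subst T (symA u v) uv

  -- The new vertex is adjacent exactly to u and v.  (The adjacency B (suc b)
  -- zero is definitionally B zero (suc b).)
  new-nbr : ∀ b → T (B zero (suc b)) → b ≡ u ⊎ b ≡ v
  new-nbr b adj with b ≟ u | b ≟ v
  ... | yes b≡u | _       = inj₁ b≡u
  ... | no _    | yes b≡v = inj₂ b≡v

  endpoint-nbr : ∀ {b} → b ≡ u ⊎ b ≡ v → T (B zero (suc b))
  endpoint-nbr {b} endpoint with b ≟ u | b ≟ v
  ... | yes _   | _       = _
  ... | no _    | yes _   = _
  ... | no b≢u  | no b≢v  = [ b≢u , b≢v ]′ endpoint

  new~u : T (B zero (suc u))
  new~u = endpoint-nbr (inj₁ refl)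

  new~v : T (B zero (suc v))
  new~v = endpoint-nbr (inj₂ refl)

  IsUV : Fin n → Fin n → Set
  IsUV a b = (a ≡ u × b ≡ v) ⊎ (a ≡ v × b ≡ u)

  isUV? : ∀ a b → Dec (IsUV a b)
  isUV? a b = (a ≟ u ×-dec b ≟ v) ⊎-dec (a ≟ v ×-dec b ≟ u)

  uv-source : ∀ {x y} → IsUV x y → x ≡ u ⊎ x ≡ v
  uv-source (inj₁ (x≡u , _)) = inj₁ x≡u
  uv-source (inj₂ (x≡v , _)) = inj₂ x≡v

  uv-target : ∀ {x y} → IsUV x y → y ≡ u ⊎ y ≡ v
  uv-target (inj₁ (_ , y≡v)) = inj₂ y≡v
  uv-target (inj₂ (_ , y≡u)) = inj₁ y≡u

  other-endpoint : ∀ {x y c} → IsUV x y → c ≡ u ⊎ c ≡ v → c ≢ y → c ≡ x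
  other-endpoint (inj₁ (refl , refl)) (inj₁ refl) _   = refl
  other-endpoint (inj₁ (refl , refl)) (inj₂ refl) c≢y = ⊥-elim (c≢y refl)
  other-endpoint (inj₂ (refl , refl)) (inj₁ refl) c≢y = ⊥-elim (c≢y refl)
  other-endpoint (inj₂ (refl , refl)) (inj₂ refl) _   = refl

  old-adjacency : ∀ a b → B (suc a) (suc b) ≡ A a b ∧ not ⌊ isUV? a b ⌋
  old-adjacency a b = cong (λ x → A a b ∧ not x) (trans
    (cong₂ _∨_ (cong₂ _∧_ (isYes≗does (a ≟ u)) (isYes≗does (b ≟ v)))
               (cong₂ _∧_ (isYes≗does (a ≟ v)) (isYes≗does (b ≟ u))))
    (sym (isYes≗does (isUV? a b))))

  old-edge : ∀ {a b} → T (B (suc a) (suc b)) → T (A a b) × ¬ IsUV a b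
  old-edge {a} {b} adj =
    let (ab , not-uv) = to T-∧ (subst T (old-adjacency a b) adj)
    in ab , toWitnessFalse {a? = isUV? a b} not-uv

  kept-edge : ∀ {a b} → T (A a b) → ¬ IsUV a b → T (B (suc a) (suc b))
  kept-edge {a} {b} ab not-uv =
    subst T (sym (old-adjacency a b)) (from T-∧ (ab , fromWitnessFalse {a? = isUV? a b} not-uv))

  not-uv-from-u : ∀ {b} → b ≢ v → ¬ IsUV u b
  not-uv-from-u b≢v (inj₁ (_ , b≡v)) = b≢v b≡v
  not-uv-from-u b≢v (inj₂ (u≡v , _)) = u≢v u≡v

  not-uv-from-v : ∀ {b} → b ≢ u → ¬ IsUV v b
  not-uv-from-v b≢u (inj₁ (v≡u , _)) = u≢v (sym v≡u)
  not-uv-from-v b≢u (inj₂ (_ , b≡u)) = b≢u b≡u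

  not-uv-other : ∀ {a b} → a ≢ u → a ≢ v → ¬ IsUV a b
  not-uv-other a≢u _ (inj₁ (a≡u , _)) = a≢u a≡u
  not-uv-other _ a≢v (inj₂ (a≡v , _)) = a≢v a≡v

  -- After the subdivision the new vertex has degree 2: besides v it is only
  -- adjacent to u.  This lets the subdivision be repeated on its edge to v.
  new-at-most-one : AtMostOneOther B zero (suc v)
  new-at-most-one {suc b} {suc c} new-b new-c b≢v c≢v =
    trans (is-u b new-b b≢v) (sym (is-u c new-c c≢v))
    where
      is-u : ∀ b → T (B zero (suc b)) → suc b ≢ suc v → suc b ≡ suc u
      is-u b adj b≢v with new-nbr b adj
      ... | inj₁ refl = refl
      ... | inj₂ refl = ⊥-elim (b≢v refl)

  -- From B to A: the new vertex is read as the pair of endpoints.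
  module Contraction (S : Subset n) where

    Read : Fin (suc n) → Set
    Read zero    = Colored A S u × Colored A S v
    Read (suc a) = Colored A S a

    -- Forcing steps of B are forcing steps (or no-ops) in A: when an endpoint
    -- forces the new vertex it forces the other endpoint in A, and a step
    -- that relies on the new vertex being colored relies on u and v.
    read-closed : ForcingClosed B Read
    read-closed {zero} {zero} _ () _
    read-closed {zero} {suc a} (cu , cv) adj _ with new-nbr a adj
    ... | inj₁ refl = cu
    ... | inj₂ refl = cv
    read-closed {suc b} {zero} cb adj rest with new-nbr b adj
    ... | inj₁ refl = cb , force cb uv (λ c uc c≢v → rest (suc c) (kept-edge uc (not-uv-from-u c≢v)) λ ())
    ... | inj₂ refl = force cb vu (λ c vc c≢u → rest (suc c) (kept-edge vc (not-uv-from-v c≢u)) λ ()) , cb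
    read-closed {suc b} {suc a} cb adj rest = force cb (proj₁ (old-edge adj)) others
      where
        others : ∀ c → T (A b c) → c ≢ a → Colored A S c
        others c bc c≢a with isUV? b c
        ... | yes (inj₁ (refl , refl)) = proj₂ (rest zero new~u λ ())
        ... | yes (inj₂ (refl , refl)) = proj₁ (rest zero new~v λ ())
        ... | no not-uv = rest (suc c) (kept-edge bc not-uv) (c≢a ∘ suc-injective)

  contract : Shrinks B A
  contract (false ∷ S) (forcing , isolated-free) = S , (forcing' , isolated-free') , ≤-refl
    where
      open Contraction S
      forcing' : ForcingSet A S
      forcing' a = colored-closed Read (λ { {suc _} (there a∈S) → init a∈S }) read-closed (forcing (suc a))
      isolated-free' : NoIsolatedIn A S
      isolated-free' a a∈S with isolated-free (suc a) (there a∈S)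
      ... | suc t , there t∈S , adj = t , t∈S , proj₁ (old-edge adj)
  contract (true ∷ S) (forcing , isolated-free) = S' , (forcing' , isolated-free') , size
    where
      S' = (S ∪ ⁅ u ⁆) ∪ ⁅ v ⁆
      open Contraction S'
      S⊆S' : S ⊆ S'
      S⊆S' a∈S = p⊆p∪q ⁅ v ⁆ (p⊆p∪q ⁅ u ⁆ a∈S)
      u∈S' : u ∈ S'
      u∈S' = p⊆p∪q ⁅ v ⁆ (q⊆p∪q S ⁅ u ⁆ (x∈⁅x⁆ u))
      v∈S' : v ∈ S'
      v∈S' = q⊆p∪q (S ∪ ⁅ u ⁆) ⁅ v ⁆ (x∈⁅x⁆ v)
      forcing' : ForcingSet A S'
      forcing' a = colored-closed Read base read-closed (forcing (suc a))
        where
          base : ∀ {x} → x ∈ true ∷ S → Read x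
          base here         = init u∈S' , init v∈S'
          base (there a∈S) = init (S⊆S' a∈S)
      endpoint-partner : ∀ {a} → a ≡ u ⊎ a ≡ v → ∃ λ t → t ∈ S' × T (A a t)
      endpoint-partner (inj₁ refl) = v , v∈S' , uv
      endpoint-partner (inj₂ refl) = u , u∈S' , vu
      isolated-free' : NoIsolatedIn A S'
      isolated-free' a a∈S' with x∈p∪q⁻ (S ∪ ⁅ u ⁆) ⁅ v ⁆ a∈S'
      ... | inj₂ a∈⁅v⁆ = endpoint-partner (inj₂ (x∈⁅y⁆⇒x≡y v a∈⁅v⁆))
      ... | inj₁ a∈S∪⁅u⁆ with x∈p∪q⁻ S ⁅ u ⁆ a∈S∪⁅u⁆
      ...   | inj₂ a∈⁅u⁆ = endpoint-partner (inj₁ (x∈⁅y⁆⇒x≡y u a∈⁅u⁆))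
      ...   | inj₁ a∈S with isolated-free (suc a) (there a∈S)
      ...     | zero , _ , adj = endpoint-partner (new-nbr a adj)
      ...     | suc t , there t∈S , adj = t , S⊆S' t∈S , proj₁ (old-edge adj)
      size : ∣ S' ∣ ≤ suc ∣ S ∣
      size with isolated-free zero here
      ... | suc t , there t∈S , adj with new-nbr t adj
      ...   | inj₁ refl = ∣p∪⁅x⁆∪⁅y⁆∣≤1+∣p∣ S (inj₁ t∈S)
      ...   | inj₂ refl = ∣p∪⁅x⁆∪⁅y⁆∣≤1+∣p∣ S (inj₂ t∈S)

  -- From A to B: old vertices are simulated by themselves.  This works as
  -- soon as the new vertex is colored whenever both endpoints are.
  module Expansion (S' : Subset (suc n)) where

    NewFollows : Set
    NewFollows = Colored B S' (suc u) → Colored B S' (suc v) → Colored B S' zero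

    endpoint-forces-new : ∀ {y} → y ≡ u ⊎ y ≡ v → Colored B S' (suc y)
                        → (∀ c → T (B (suc y) (suc c)) → Colored B S' (suc c))
                        → Colored B S' zero
    endpoint-forces-new endpoint cy old-nbrs = force cy (endpoint-nbr endpoint) others
      where
        others : ∀ t → T (B (suc _) t) → t ≢ zero → Colored B S' t
        others zero    _   ne = ⊥-elim (ne refl)
        others (suc c) adj _  = old-nbrs c adj

    new-forces : ∀ {x y} → IsUV x y → Colored B S' zero → Colored B S' (suc x)
               → Colored B S' (suc y)
    new-forces {x} {y} xy cnew cx = force cnew (endpoint-nbr (uv-target xy)) others
      where
        others : ∀ t → T (B zero t) → t ≢ suc y → Colored B S' t
        others (suc c) adj c≢y =
          subst (λ c → Colored B S' (suc c)) (sym (other-endpoint xy (new-nbr c adj) (c≢y ∘ cong suc))) cx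

    -- A forcing step x → y of A is simulated in B: along uv by two steps
    -- through the new vertex, along any other edge directly.
    expand-closed : NewFollows → ForcingClosed A (λ a → Colored B S' (suc a))
    expand-closed new-follows {x} {y} cx xy rest with isUV? x y
    ... | yes x-y = new-forces x-y (endpoint-forces-new (uv-source x-y) cx old-nbrs) cx
      where
        old-nbrs : ∀ c → T (B (suc x) (suc c)) → Colored B S' (suc c)
        old-nbrs c adj = let (xc , not-uv) = old-edge adj in
          rest c xc λ { refl → not-uv x-y }
    ... | no not-uv = force cx (kept-edge xy not-uv) others
      where
        others : ∀ t → T (B (suc x) t) → t ≢ suc y → Colored B S' t
        others (suc c) adj c≢y = rest c (proj₁ (old-edge adj)) (c≢y ∘ cong suc)
        others zero adj _ with new-nbr x adj
        ... | inj₁ refl = new-follows cx (rest v uv λ { refl → not-uv (inj₁ (refl , refl)) })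
        ... | inj₂ refl = new-follows (rest u vu λ { refl → not-uv (inj₂ (refl , refl)) }) cx

    expand-forcing : ∀ {S} → (∀ {a} → a ∈ S → Colored B S' (suc a)) → NewFollows
                   → ForcingSet A S → ForcingSet B S'
    expand-forcing base new-follows forcing (suc a) =
      colored-closed (λ a → Colored B S' (suc a)) base (expand-closed new-follows) (forcing a)
    expand-forcing base new-follows forcing zero =
      endpoint-forces-new (inj₁ refl) (old u) (λ c _ → old c)
      where
        old : ∀ a → Colored B S' (suc a)
        old = expand-forcing base new-follows forcing ∘ suc

  keep : ∀ {S} → TFSet A S → Expansion.NewFollows (false ∷ S)
       → (u ∈ S → HasOtherNbrIn A S u v) → (v ∈ S → HasOtherNbrIn A S v u)
       → TFSet B (false ∷ S)
  keep {S} (forcing , isolated-free) new-follows u-partner v-partner =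
    Expansion.expand-forcing (false ∷ S) (init ∘ there) new-follows forcing , isolated-free'
    where
      isolated-free' : NoIsolatedIn B (false ∷ S)
      isolated-free' (suc a) (there a∈S) with a ≟ u | a ≟ v
      ... | yes refl | _ = let (t , t∈S , at , t≢v) = u-partner a∈S in
                           suc t , there t∈S , kept-edge at (not-uv-from-u t≢v)
      ... | no _ | yes refl = let (t , t∈S , at , t≢u) = v-partner a∈S in
                              suc t , there t∈S , kept-edge at (not-uv-from-v t≢u)
      ... | no a≢u | no a≢v = let (t , t∈S , at) = isolated-free a a∈S in
                              suc t , there t∈S , kept-edge at (not-uv-other a≢u a≢v)

  -- If v ∈ S has no neighbour in S besides u ∈ S, the new vertex may replace
  -- v: it forces v, and it is adjacent to u.
  replace-endpoint : ∀ {S} → TFSet A S → u ∈ S → v ∈ S → ¬ HasOtherNbrIn A S v u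
                   → TFSet B (true ∷ (S - v))
  replace-endpoint {S} (forcing , isolated-free) u∈S v∈S v-lonely =
    Expansion.expand-forcing S' base (λ _ _ → init here) forcing , isolated-free'
    where
      S' = true ∷ (S - v)
      u∈S-v : u ∈ S - v
      u∈S-v = x∈p∧x≢y⇒x∈p-y u∈S u≢v
      base : ∀ {a} → a ∈ S → Colored B S' (suc a)
      base {a} a∈S with a ≟ v
      ... | yes refl = Expansion.new-forces S' (inj₁ (refl , refl)) (init here) (init (there u∈S-v))
      ... | no a≢v = init (there (x∈p∧x≢y⇒x∈p-y a∈S a≢v))
      isolated-free' : NoIsolatedIn B S'
      isolated-free' zero here = suc u , there u∈S-v , new~u
      isolated-free' (suc a) (there a∈S-v) with ∈p-y⁻ a∈S-v | a ≟ u
      ... | _ | yes refl = zero , here , new~u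
      ... | a∈S , a≢v | no a≢u with isolated-free a a∈S
      ...   | t , t∈S , at with t ≟ v
      ...     | yes refl = contradiction (a , a∈S , subst T (symA a t) at , a≢u) v-lonely
      ...     | no t≢v = suc t , there (x∈p∧x≢y⇒x∈p-y t∈S t≢v) , kept-edge at (not-uv-other a≢u a≢v)

  -- When u has at most one neighbour x besides v, the new vertex follows u
  -- for a set without the new vertex: if u ∉ S it was forced by the new vertex
  -- or by x, and if u has a neighbour in S besides v, that neighbour is x; in
  -- both cases, once u is colored, all of its old neighbours in B are x, so u
  -- forces the new vertex.
  module ShortEndpoint (at-most-one : AtMostOneOther A u v) (S : Subset n) where
    open Expansion (false ∷ S)

    u-forces-new : ∀ {x} → Colored B (false ∷ S) (suc x) → T (A u x) → x ≢ v
                 → Colored B (false ∷ S) (suc u) → Colored B (false ∷ S) zero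
    u-forces-new {x} cx ux x≢v cu = endpoint-forces-new (inj₁ refl) cu old-nbrs
      where
        old-nbrs : ∀ c → T (B (suc u) (suc c)) → Colored B (false ∷ S) (suc c)
        old-nbrs c adj = let (uc , not-uv) = old-edge adj in
          subst (λ c → Colored B (false ∷ S) (suc c))
                (at-most-one ux uc x≢v λ { refl → not-uv (inj₁ (refl , refl)) }) cx

    forced-u-forces-new : u ∉ S → Colored B (false ∷ S) (suc u) → Colored B (false ∷ S) zero
    forced-u-forces-new u∉S (init (there u∈S)) = ⊥-elim (u∉S u∈S)
    forced-u-forces-new u∉S (force {zero} cnew _ _) = cnew
    forced-u-forces-new u∉S cu@(force {suc x} cx adj _) =
      let (xu , not-vu) = old-edge adj in
      u-forces-new cx (subst T (symA x u) xu) (λ { refl → not-vu (inj₂ (refl , refl)) }) cu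

    new-follows : (u ∈ S → HasOtherNbrIn A S u v) → NewFollows
    new-follows u-partner cu _ with u ∈? S
    ... | yes u∈S = let (x , x∈S , ux , x≢v) = u-partner u∈S in
                    u-forces-new (init (there x∈S)) ux x≢v cu
    ... | no u∉S = forced-u-forces-new u∉S cu

subdivide1-swap : ∀ {n} (A : AdjRel n) u v a b → subdivide1 A u v a b ≡ subdivide1 A v u a b
subdivide1-swap A u v zero    zero    = refl
subdivide1-swap A u v zero    (suc b) = ∨-comm ⌊ b ≟ u ⌋ ⌊ b ≟ v ⌋
subdivide1-swap A u v (suc a) zero    = ∨-comm ⌊ a ≟ u ⌋ ⌊ a ≟ v ⌋
subdivide1-swap A u v (suc a) (suc b) =
  cong (λ x → A a b ∧ not x) (∨-comm (⌊ a ≟ u ⌋ ∧ ⌊ b ≟ v ⌋) (⌊ a ≟ v ⌋ ∧ ⌊ b ≟ u ⌋))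

subdivide1-simple : ∀ {n} (A : AdjRel n) u v → IsSimple A → IsSimple (subdivide1 A u v)
subdivide1-simple A u v (symA , irrefl) = sym' , irrefl'
  where
    sym' : ∀ a b → subdivide1 A u v a b ≡ subdivide1 A u v b a
    sym' zero    zero    = refl
    sym' zero    (suc b) = refl
    sym' (suc a) zero    = refl
    sym' (suc a) (suc b) = cong₂ (λ x y → x ∧ not y) (symA a b) (trans
      (∨-comm (⌊ a ≟ u ⌋ ∧ ⌊ b ≟ v ⌋) (⌊ a ≟ v ⌋ ∧ ⌊ b ≟ u ⌋))
      (cong₂ _∨_ (∧-comm ⌊ a ≟ v ⌋ ⌊ b ≟ u ⌋) (∧-comm ⌊ a ≟ u ⌋ ⌊ b ≟ v ⌋)))
    irrefl' : ∀ a → subdivide1 A u v a a ≡ false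
    irrefl' zero    = refl
    irrefl' (suc a) = cong (λ x → x ∧ _) (irrefl a)

edge-distinct : ∀ {n} {A : AdjRel n} {u v} → IsSimple A → T (A u v) → u ≢ v
edge-distinct {u = u} (_ , irrefl) uv refl = subst T (irrefl u) uv

edge-flip : ∀ {n} {A : AdjRel n} {u v} → IsSimple A → T (A u v) → T (A v u)
edge-flip {u = u} {v} (symA , _) = subst T (symA u v)

-- Every TF-set of A yields a TF-set of B that is no larger: it is kept, or
-- the new vertex replaces an endpoint having no other neighbour in it.
expand : ∀ {n} {A : AdjRel n} {u v} (s : IsSimple A) (uv : T (A u v))
       → AtMostOneOther A u v → Shrinks A (subdivide1 A u v)
expand {A = A} {u} {v} s uv at-most-one S tf
  with (u ∈? S) →-dec hasOtherNbrIn? A S u v | (v ∈? S) →-dec hasOtherNbrIn? A S v u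
... | yes u-partner | yes v-partner =
  false ∷ S , keep tf (ShortEndpoint.new-follows at-most-one S u-partner) u-partner v-partner , ≤-refl
  where open Subdivision A (proj₁ s) u v uv (edge-distinct s uv)
... | no no-u-partner | _ =
  true ∷ (S - u) , TFSet-resp (subdivide1-swap A v u) replaced , x∈p⇒∣p-x∣<∣p∣ u∈S
  where
    vu : T (A v u)
    vu = edge-flip s uv
    u∈S : u ∈ S
    u∈S = proj₁ (counterexample (u ∈? S) no-u-partner)
    u-lonely : ¬ HasOtherNbrIn A S u v
    u-lonely = proj₂ (counterexample (u ∈? S) no-u-partner)
    replaced : TFSet (subdivide1 A v u) (true ∷ (S - u))
    replaced = Subdivision.replace-endpoint A (proj₁ s) v u vu (edge-distinct s vu) tf
                 (lonely-partner (proj₂ tf) u∈S u-lonely) u∈S u-lonely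
... | yes _ | no no-v-partner =
  true ∷ (S - v) , replace-endpoint tf (lonely-partner (proj₂ tf) v∈S v-lonely) v∈S v-lonely ,
  x∈p⇒∣p-x∣<∣p∣ v∈S
  where
    open Subdivision A (proj₁ s) u v uv (edge-distinct s uv)
    v∈S : v ∈ S
    v∈S = proj₁ (counterexample (v ∈? S) no-v-partner)
    v-lonely : ¬ HasOtherNbrIn A S v u
    v-lonely = proj₂ (counterexample (v ∈? S) no-v-partner)

subdivide1-sameFt : ∀ {n} {A : AdjRel n} {u v} → IsSimple A → T (A u v)
                  → AtMostOneOther A u v ⊎ AtMostOneOther A v u → SameFt A (subdivide1 A u v)
subdivide1-sameFt {A = A} {u} {v} s uv (inj₁ at-most-one) =
  sameFt (expand s uv at-most-one) (Subdivision.contract A (proj₁ s) u v uv (edge-distinct s uv))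
subdivide1-sameFt {A = A} {u} {v} s uv (inj₂ at-most-one) =
  sameFt-trans (subdivide1-sameFt s (edge-flip s uv) (inj₁ at-most-one))
               (sameFt-resp (subdivide1-swap A v u))

-- Repeated subdivision: each new vertex has degree 2 in the next step.
subdivide-sameFt : ∀ k {n} {A : AdjRel n} {u v} → IsSimple A → T (A u v)
                 → AtMostOneOther A u v ⊎ AtMostOneOther A v u → SameFt A (subdivide A u v k)
subdivide-sameFt zero    _ _ _ m = id , id
subdivide-sameFt (suc k) {A = A} {u} {v} s uv at-most-one =
  sameFt-trans (subdivide1-sameFt s uv at-most-one)
               (subdivide-sameFt k (subdivide1-simple A u v s) new~v (inj₁ new-at-most-one))
  where open Subdivision A (proj₁ s) u v uv (edge-distinct s uv)

-- The theorem: a degree bound at either endpoint gives "at most one other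
-- neighbour" there.
lemma2 : ∀ {n : ℕ} (A : AdjRel n) → IsSimple A → NoIsolated A
         → (u v : Fin n) → T (A u v) → (deg A u ≤ 2 ⊎ deg A v ≤ 2)
         → (k m : ℕ) → (IsFt A m → IsFt (subdivide A u v k) m) × (IsFt (subdivide A u v k) m → IsFt A m)
lemma2 A s _ u v uv small-degree k =
  subdivide-sameFt k s uv
    (Sum.map (deg≤2⇒atMostOneOther {A = A} uv)
             (deg≤2⇒atMostOneOther {A = A} (edge-flip s uv)) small-degree)
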